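{- (1) There is an absolute constant $C>0$ such that almost every zero-one $m\times n$ matrix with $m\ge C\log n$ and $n\ge C\log m$ is shattered; that is, among all $2^{mn}$ zero-one $m\times n$ matrices satisfying these inequalities, the proportion that are shattered tends to $1$ as $m,n\to\infty$. (2) For even $n$, the number of $3$-existentially complete triangle-free graphs on $n$ vertices is at least $2^{n^2/(16+o(1))}$ (as $n\to\infty$).
   Context: An $m\times n$ zero-one matrix $M$ is \emph{shattered} if for any three distinct rows $i,j,k$ the submatrix on these rows contains, as columns $(M_{il},M_{jl},M_{kl})$, at least one of $000,111$, at least one of $001,110$, at least one of $010,101$, and at least one of $100,011$; and the same holds for any three distinct columns. A graph $G=(V,E)$ is \emph{$3$-existentially complete triangle-free} if it is triangle-free and for every $B\subseteq A\subseteq V$ with $|A|\le 3$ and $B$ independent, there exists a vertex $v\in V\setminus A$ adjacent to every vertex of $B$ and to no vertex of $A\setminus B$. -}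

module Defs where

open import Data.Nat using (ℕ; zero; suc; _≤_; _≤?_)
open import Data.Bool using (Bool; true; false; not) renaming (_≟_ to _≟ᵇ_)
open import Data.Fin using (Fin) renaming (_≟_ to _≟ᶠ_)
open import Data.Fin.Properties using (all?; any?)
open import Data.Fin.Subset using (Subset; _∈_; _∉_; _⊆_; ∣_∣)
open import Data.Fin.Subset.Properties using (_∈?_; _⊆?_; anySubset?)
open import Data.Vec using (Vec; []; _∷_; lookup)
open import Data.List using (List; []; _∷_; [_]; map; concatMap; filter; length)
open import Data.Product using (Σ; ∃; _×_; _,_)
open import Data.Product.Properties using (≡-dec)
open import Data.Sum using (_⊎_)
open import Data.Empty using (⊥)
open import Relation.Nullary using (Dec; yes; no; ¬_)
open import Relation.Nullary.Decidable using (_×-dec_; _⊎-dec_; _→-dec_; ¬?; map′)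
open import Relation.Binary.PropositionalEquality using (_≡_; _≢_)

allVecs : ∀ {a} {A : Set a} (k : ℕ) → List A → List (Vec A k)
allVecs zero    xs = [ [] ]
allVecs (suc k) xs = concatMap (λ x → map (x ∷_) (allVecs k xs)) xs

Matrix : ℕ → ℕ → Set
Matrix m n = Vec (Vec Bool n) m

allMatrices : (m n : ℕ) → List (Matrix m n)
allMatrices m n = allVecs m (allVecs n (true ∷ false ∷ []))

entry : ∀ {m n} → Matrix m n → Fin m → Fin n → Bool
entry M i l = lookup (lookup M i) l

countDec : ∀ {a p} {A : Set a} {P : A → Set p} → ((x : A) → Dec (P x)) → List A → ℕ
countDec P? xs = length (filter P? xs)

Distinct3 : ∀ {a} → Fin a → Fin a → Fin a → Set
Distinct3 i j k = i ≢ j × j ≢ k × i ≢ k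

-- Condition on lines (rows of e): for any three distinct lines i,j,k and
-- any pattern (a,b,c) there is a position l whose triple
-- (e i l , e j l , e k l) is (a,b,c) or its complement.
-- (Ranging over all 8 patterns = the 4 complementary pairs 000/111,
--  001/110, 010/101, 100/011 of the definition.)
ThreeShattered : ∀ {a b} → (Fin a → Fin b → Bool) → Set
ThreeShattered {a} {b} e =
  ∀ (i j k : Fin a) → Distinct3 i j k →
  ∀ (x y z : Bool) → ∃ λ (l : Fin b) →
    ((e i l , e j l , e k l) ≡ (x , y , z)) ⊎
    ((e i l , e j l , e k l) ≡ (not x , not y , not z))

Shattered : ∀ {m n} → Matrix m n → Set
Shattered M = ThreeShattered (entry M) × ThreeShattered (λ i l → entry M l i)

Adj : ∀ {n} → Matrix n n → Fin n → Fin n → Set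
Adj M i j = entry M i j ≡ true

IsGraph : ∀ {n} → Matrix n n → Set
IsGraph {n} M = (∀ (i : Fin n) → entry M i i ≡ false) ×
                (∀ (i j : Fin n) → entry M i j ≡ entry M j i)

TriangleFree : ∀ {n} → Matrix n n → Set
TriangleFree {n} M = ∀ (i j k : Fin n) → Adj M i j → Adj M j k → Adj M i k → ⊥

Independent : ∀ {n} → Matrix n n → Subset n → Set
Independent {n} M B = ∀ (u w : Fin n) → u ∈ B → w ∈ B → ¬ Adj M u w

ThreeECTF : ∀ {n} → Matrix n n → Set
ThreeECTF {n} M = TriangleFree M ×
  (∀ (A B : Subset n) → B ⊆ A → ∣ A ∣ ≤ 3 → Independent M B →
     ∃ λ (v : Fin n) → v ∉ A ×
       (∀ (u : Fin n) → u ∈ B → Adj M v u) ×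
       (∀ (u : Fin n) → u ∈ A → u ∉ B → ¬ Adj M v u))

private
  allBool? : ∀ {p} {P : Bool → Set p} → ((x : Bool) → Dec (P x)) → Dec (∀ x → P x)
  allBool? P? with P? true | P? false
  ... | yes pt | yes pf = yes λ { true → pt ; false → pf }
  ... | no ¬pt | _      = no λ h → ¬pt (h true)
  ... | yes _  | no ¬pf = no λ h → ¬pf (h false)

  allSubset? : ∀ {n p} {P : Subset n → Set p} → ((s : Subset n) → Dec (P s)) → Dec (∀ s → P s)
  allSubset? {P = P} P? with anySubset? (λ s → ¬? (P? s))
  ... | yes (s , ¬ps) = no λ h → ¬ps (h s)
  ... | no ¬ex = yes λ s → Relation.Nullary.Decidable.decidable-stable (P? s) (λ ¬ps → ¬ex (s , ¬ps))
    where import Relation.Nullary.Decidable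

  triple? : (p q : Bool × Bool × Bool) → Dec (p ≡ q)
  triple? = ≡-dec _≟ᵇ_ (≡-dec _≟ᵇ_ _≟ᵇ_)

  distinct? : ∀ {a} (i j k : Fin a) → Dec (Distinct3 i j k)
  distinct? i j k = ¬? (i ≟ᶠ j) ×-dec (¬? (j ≟ᶠ k) ×-dec ¬? (i ≟ᶠ k))

threeShattered? : ∀ {a b} (e : Fin a → Fin b → Bool) → Dec (ThreeShattered e)
threeShattered? e =
  all? λ i → all? λ j → all? λ k → distinct? i j k →-dec
  allBool? λ x → allBool? λ y → allBool? λ z → any? λ l →
    triple? _ _ ⊎-dec triple? _ _

shattered? : ∀ {m n} (M : Matrix m n) → Dec (Shattered M)
shattered? M = threeShattered? (entry M) ×-dec threeShattered? (λ i l → entry M l i)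

private
  adj? : ∀ {n} (M : Matrix n n) i j → Dec (Adj M i j)
  adj? M i j = entry M i j ≟ᵇ true

isGraph? : ∀ {n} (M : Matrix n n) → Dec (IsGraph M)
isGraph? M = (all? λ i → entry M i i ≟ᵇ false) ×-dec
             (all? λ i → all? λ j → entry M i j ≟ᵇ entry M j i)

threeECTF? : ∀ {n} (M : Matrix n n) → Dec (ThreeECTF M)
threeECTF? M =
  (all? λ i → all? λ j → all? λ k → adj? M i j →-dec (adj? M j k →-dec (adj? M i k →-dec no λ ())))
  ×-dec
  (allSubset? λ A → allSubset? λ B → (B ⊆? A) →-dec ((∣ A ∣ ≤? 3) →-dec
    ((all? λ u → all? λ w → (u ∈? B) →-dec ((w ∈? B) →-dec ¬? (adj? M u w))) →-dec
     any? λ v → ¬? (v ∈? A) ×-dec ((all? λ u → (u ∈? B) →-dec adj? M v u) ×-dec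
        (all? λ u → (u ∈? A) →-dec (¬? (u ∈? B) →-dec ¬? (adj? M v u)))))))

numShattered : ℕ → ℕ → ℕ
numShattered m n = countDec shattered? (allMatrices m n)

numThreeECTF : ℕ → ℕ
numThreeECTF n = countDec (λ M → isGraph? M ×-dec threeECTF? M) (allMatrices n n)

module Submission where

-- (1) If rows i, j, k of M are not shattered, some triple p and its complement occur in no column,
-- so M is determined by (i, j, k, p), its n column triples (six possible values each) and its other
-- m − 3 rows: there are at most 8m³·6ⁿ·2^(n(m−3)) = 8m³(3/4)ⁿ·2^(mn) such matrices, and likewise for
-- columns. Under m¹⁰ ≤ 2ⁿ and n¹⁰ ≤ 2^m this is a vanishing fraction (take tenth powers; 3¹⁰ ≤ 2¹⁶).
--
-- (2) An r × c matrix e gives a graph on the 2r + 2c vertices (i, s) and (l, t), s, t ∈ Bool: the pairs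
-- (i, s) — (i, not s) and (l, t) — (l, not t) form a perfect matching, and (i, s) — (l, t) iff
-- e i l ⊕ s ⊕ t. It is triangle-free, and if e and its transpose are shattered it is 3-existentially
-- complete: up to transposition two of the three prescribed vertices are row vertices, and shattering
-- of the rows yields a column vertex with the prescribed adjacencies; the degenerate configurations are
-- served by the partner of a prescribed vertex or by a vertex in a fresh row. Distinct matrices give
-- distinct graphs, and for r, c ≈ n/4 at least half of the 2^(rc) ≥ 2^(n²/16 − 1) matrices are
-- shattered by (1).

open import Defs
open import Data.Nat using (ℕ; zero; suc; _+_; _*_; _∸_; _^_; _≤_; _<_; z≤n; s≤s; _≤?_; NonZero)
open import Data.Nat.Properties hiding (_≟_)
open import Data.Nat.Divisibility using (_∣_; divides)
open import Data.Nat.Solver using (module +-*-Solver)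
open import Data.Bool using (Bool; true; false; not; _∧_; _xor_) renaming (_≟_ to _≟ᵇ_)
open import Data.Bool.Properties
  using (xor-comm; xor-same; xor-inverseˡ; xor-identityʳ; not-distribˡ-xor; not-distribʳ-xor; not-¬; ¬-not; not-involutive)
open import Data.Fin using (Fin; zero; suc; _≟_; fromℕ<)
open import Data.Fin.Properties using (any?; all?; +↔⊎)
open import Data.Fin.Subset using (Subset; ∣_∣; _⊆_) renaming (_∈_ to _∈ₛ_; _∉_ to _∉ₛ_)
open import Data.Fin.Subset.Properties using () renaming (_∈?_ to _∈ₛ?_)
open import Data.Vec using (Vec; []; _∷_; here; there; lookup; tabulate)
open import Data.Vec.Properties using (tabulate∘lookup; tabulate-cong; ∷-injective; lookup∘tabulate)
open import Data.List using (List; []; _∷_; map; filter; length; _++_; concatMap; cartesianProductWith; cartesianProduct; allFin)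
import Data.List as List
open import Data.List.Properties using (length-map; length-++; length-removeAt′; length-tabulate; length-filter)
open import Data.List.Membership.Propositional using (_∈_; _─_; lose; find)
open import Data.List.Membership.Propositional.Properties
  using (∈-filter⁺; ∈-filter⁻; ∈-map⁺; ∈-map⁻; ∈-cartesianProductWith⁺; ∈-cartesianProduct⁺; ∈-concatMap⁺; ∈-allFin)
open import Data.List.Relation.Unary.Any using (here; there)
import Data.List.Relation.Unary.Any as Any
open import Data.List.Relation.Unary.Any.Properties using (lookup-index)
open import Data.List.Relation.Unary.All using ([]; _∷_)
import Data.List.Relation.Unary.All as All
open import Data.List.Relation.Unary.Unique.Propositional using (Unique; []; _∷_)
import Data.List.Relation.Unary.Unique.Propositional.Properties as Unique
open import Data.Product using (Σ; ∃; _×_; _,_; proj₁; proj₂)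
open import Data.Product.Properties using (≡-dec; ,-injective)
open import Data.Sum using (_⊎_; inj₁; inj₂; swap; [_,_]′)
open import Data.Sum.Properties using (inj₁-injective; inj₂-injective; swap-involutive)
open import Data.Sum.Function.Propositional using (_⊎-↔_)
open import Data.Empty using (⊥; ⊥-elim)
open import Function using (_∘_; id; flip)
open import Function.Bundles using (_↔_; mk↔ₛ′; Inverse)
open import Function.Properties.Inverse using (↔-trans)
open import Level using (Level)
open import Relation.Nullary using (Dec; yes; no; does; ¬_; ¬?; contradiction)
open import Relation.Nullary.Decidable using (_×-dec_; _⊎-dec_; map′; toWitness; dec-true; dec-false)
open import Relation.Unary using (Pred; Decidable)
open import Relation.Binary.PropositionalEquality

open +-*-Solver

private
  variable
    ℓ ℓ₁ ℓ₂ ℓ₃ : Level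
    A : Set ℓ₁
    B : Set ℓ₂
    C : Set ℓ₃

∈-─ : ∀ {x y} {ys : List A} (y∈ys : y ∈ ys) → x ∈ ys → x ≢ y → x ∈ ys ─ y∈ys
∈-─ (here refl) (here refl) x≢y = contradiction refl x≢y
∈-─ (here refl) (there x∈ys) _   = x∈ys
∈-─ (there _)   (here x≡)    _   = here x≡
∈-─ (there y∈ys) (there x∈ys) x≢y = there (∈-─ y∈ys x∈ys x≢y)

length-≤-by-injection : (R : A → B → Set ℓ) → (∀ {x x′ y} → R x y → R x′ y → x ≡ x′) →
  ∀ {xs ys} → Unique xs → (∀ {x} → x ∈ xs → ∃ λ y → y ∈ ys × R x y) → length xs ≤ length ys
length-≤-by-injection R inj {[]}     _            _     = z≤n
length-≤-by-injection R inj {x ∷ xs} {ys} (x∉xs ∷ xs!) image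
  with y , y∈ys , Rxy ← image (here refl) = begin
    suc (length xs)          ≤⟨ s≤s (length-≤-by-injection R inj xs! image′) ⟩
    suc (length (ys ─ y∈ys)) ≡⟨ sym (length-removeAt′ ys _) ⟩
    length ys                ∎
  where
  open ≤-Reasoning
  image′ : ∀ {x′} → x′ ∈ xs → ∃ λ y′ → y′ ∈ ys ─ y∈ys × R x′ y′
  image′ x′∈xs with y′ , y′∈ys , Rx′y′ ← image (there x′∈xs) =
    y′ , ∈-─ y∈ys y′∈ys (λ { refl → All.lookup x∉xs x′∈xs (inj Rxy Rx′y′) }) , Rx′y′

length-filter-≤-by-injection : ∀ {p} {P : Pred A p} (P? : Decidable P) (R : A → B → Set ℓ) →
  (∀ {x x′ y} → R x y → R x′ y → x ≡ x′) →
  ∀ {xs ys} → Unique xs → (∀ {x} → x ∈ xs → P x → ∃ λ y → y ∈ ys × R x y) →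
  length (filter P? xs) ≤ length ys
length-filter-≤-by-injection P? R inj xs! image =
  length-≤-by-injection R inj (Unique.filter⁺ P? xs!) λ x∈ → let x∈xs , Px = ∈-filter⁻ P? x∈ in image x∈xs Px

module _ {p} {P : Pred A p} (P? : Decidable P) where

  length-filter-+-filter-¬ : ∀ xs → length (filter P? xs) + length (filter (¬? ∘ P?) xs) ≡ length xs
  length-filter-+-filter-¬ [] = refl
  length-filter-+-filter-¬ (x ∷ xs) with P? x
  ... | yes _ = cong suc (length-filter-+-filter-¬ xs)
  ... | no  _ = trans (+-suc _ _) (cong suc (length-filter-+-filter-¬ xs))

  module _ {q r} {Q : Pred A q} {R : Pred A r} (Q? : Decidable Q) (R? : Decidable R) where

    length-filter-≤-+ : (∀ {x} → P x → Q x ⊎ R x) → ∀ xs →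
      length (filter P? xs) ≤ length (filter Q? xs) + length (filter R? xs)
    length-filter-≤-+ P⇒Q⊎R [] = z≤n
    length-filter-≤-+ P⇒Q⊎R (x ∷ xs) with ih ← length-filter-≤-+ P⇒Q⊎R xs | P? x | Q? x | R? x
    ... | no _   | no _  | no _  = ih
    ... | no _   | yes _ | no _  = m≤n⇒m≤1+n ih
    ... | no _   | no _  | yes _ = ≤-trans ih (+-monoʳ-≤ _ (n≤1+n _))
    ... | no _   | yes _ | yes _ = m≤n⇒m≤1+n (≤-trans ih (+-monoʳ-≤ _ (n≤1+n _)))
    ... | yes _  | yes _ | no _  = s≤s ih
    ... | yes _  | yes _ | yes _ = s≤s (≤-trans ih (+-monoʳ-≤ _ (n≤1+n _)))
    ... | yes _  | no _  | yes _ = ≤-trans (s≤s ih) (≤-reflexive (sym (+-suc _ _)))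
    ... | yes Px | no ¬Q | no ¬R = ⊥-elim ([ ¬Q , ¬R ]′ (P⇒Q⊎R Px))

lookup-ext : ∀ {k} {u v : Vec A k} → (∀ i → lookup u i ≡ lookup v i) → u ≡ v
lookup-ext {u = u} {v} eq = trans (sym (tabulate∘lookup u)) (trans (tabulate-cong eq) (tabulate∘lookup v))

entry-ext : ∀ {m n} {M M′ : Matrix m n} → (∀ i l → entry M i l ≡ entry M′ i l) → M ≡ M′
entry-ext eq = lookup-ext λ i → lookup-ext (eq i)

entry-tabulate : ∀ {m n} (f : Fin m → Fin n → Bool) i j → entry (tabulate λ i → tabulate (f i)) i j ≡ f i j
entry-tabulate f i j = trans (cong (λ row → lookup row j) (lookup∘tabulate _ i)) (lookup∘tabulate (f i) j)

length-cartesianProductWith : ∀ (f : A → B → C) xs ys →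
  length (cartesianProductWith f xs ys) ≡ length xs * length ys
length-cartesianProductWith f []       ys = refl
length-cartesianProductWith f (x ∷ xs) ys =
  trans (length-++ (map (f x) ys)) (cong₂ _+_ (length-map (f x) ys) (length-cartesianProductWith f xs ys))

concatMap-map≡cartesianProductWith : ∀ (f : A → B → C) xs ys →
  concatMap (λ x → map (f x) ys) xs ≡ cartesianProductWith f xs ys
concatMap-map≡cartesianProductWith f []       ys = refl
concatMap-map≡cartesianProductWith f (x ∷ xs) ys =
  cong (map (f x) ys ++_) (concatMap-map≡cartesianProductWith f xs ys)

allVecs-suc : ∀ k (xs : List A) → allVecs (suc k) xs ≡ cartesianProductWith _∷_ xs (allVecs k xs)
allVecs-suc k xs = concatMap-map≡cartesianProductWith _∷_ xs (allVecs k xs)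

length-allVecs : ∀ k (xs : List A) → length (allVecs k xs) ≡ length xs ^ k
length-allVecs zero    xs = refl
length-allVecs (suc k) xs = begin
  length (allVecs (suc k) xs)                         ≡⟨ cong length (allVecs-suc k xs) ⟩
  length (cartesianProductWith _∷_ xs (allVecs k xs)) ≡⟨ length-cartesianProductWith _∷_ xs _ ⟩
  length xs * length (allVecs k xs)                   ≡⟨ cong (length xs *_) (length-allVecs k xs) ⟩
  length xs * length xs ^ k                           ∎
  where open ≡-Reasoning

∈-allVecs : ∀ {k} {xs : List A} (v : Vec A k) → (∀ i → lookup v i ∈ xs) → v ∈ allVecs k xs
∈-allVecs []      _     = here refl
∈-allVecs {xs = xs} (x ∷ v) v⊆xs = subst (x ∷ v ∈_) (sym (allVecs-suc _ xs))
  (∈-cartesianProductWith⁺ _∷_ (v⊆xs zero) (∈-allVecs v (v⊆xs ∘ suc)))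

allVecs-unique : ∀ k {xs : List A} → Unique xs → Unique (allVecs k xs)
allVecs-unique zero    _   = [] ∷ []
allVecs-unique (suc k) {xs} xs! = subst Unique (sym (allVecs-suc k xs))
  (Unique.cartesianProductWith⁺ _∷_ ∷-injective xs! (allVecs-unique k xs!))

bits : List Bool
bits = true ∷ false ∷ []

∈-bits : ∀ x → x ∈ bits
∈-bits true  = here refl
∈-bits false = there (here refl)

∈-allMatrices : ∀ {m n} (M : Matrix m n) → M ∈ allMatrices m n
∈-allMatrices M = ∈-allVecs M λ i → ∈-allVecs (lookup M i) λ l → ∈-bits _

allMatrices-unique : ∀ m n → Unique (allMatrices m n)
allMatrices-unique m n = allVecs-unique m (allVecs-unique n (((λ ()) ∷ []) ∷ [] ∷ []))

length-allMatrices : ∀ m n → length (allMatrices m n) ≡ 2 ^ (m * n)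
length-allMatrices m n = begin
  length (allVecs m (allVecs n bits)) ≡⟨ length-allVecs m _ ⟩
  length (allVecs n bits) ^ m         ≡⟨ cong (_^ m) (length-allVecs n bits) ⟩
  (2 ^ n) ^ m                         ≡⟨ ^-*-assoc 2 n m ⟩
  2 ^ (n * m)                         ≡⟨ cong (2 ^_) (*-comm n m) ⟩
  2 ^ (m * n)                         ∎
  where open ≡-Reasoning

∈-concatMap⁺′ : ∀ (f : A → List B) {x y xs} → x ∈ xs → y ∈ f x → y ∈ concatMap f xs
∈-concatMap⁺′ f x∈xs y∈fx = ∈-concatMap⁺ f (lose x∈xs y∈fx)

length-concatMap-≤ : ∀ (f : A → List B) {k} xs → (∀ {x} → x ∈ xs → length (f x) ≤ k) →
  length (concatMap f xs) ≤ length xs * k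
length-concatMap-≤ f []       _     = z≤n
length-concatMap-≤ f {k} (x ∷ xs) bound = begin
  length (f x ++ concatMap f xs)          ≡⟨ length-++ (f x) ⟩
  length (f x) + length (concatMap f xs)  ≤⟨ +-mono-≤ (bound (here refl)) (length-concatMap-≤ f xs (bound ∘ there)) ⟩
  length (x ∷ xs) * k                     ∎
  where open ≤-Reasoning

Triple : Set
Triple = Bool × Bool × Bool

complement : Triple → Triple
complement (x , y , z) = not x , not y , not z

Meets : Triple → Triple → Set
Meets p t = t ≡ p ⊎ t ≡ complement p

meets? : ∀ p t → Dec (Meets p t)
meets? p t = (t ≟₃ p) ⊎-dec (t ≟₃ complement p)
  where _≟₃_ = ≡-dec _≟ᵇ_ (≡-dec _≟ᵇ_ _≟ᵇ_)

triples : List Triple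
triples = cartesianProduct bits (cartesianProduct bits bits)

∈-triples : ∀ t → t ∈ triples
∈-triples (x , y , z) = ∈-cartesianProduct⁺ (∈-bits x) (∈-cartesianProduct⁺ (∈-bits y) (∈-bits z))

avoiding : Triple → List Triple
avoiding p = filter (¬? ∘ meets? p) triples

length-avoiding : ∀ p → length (avoiding p) ≡ 6
length-avoiding (true  , true  , true ) = refl
length-avoiding (true  , true  , false) = refl
length-avoiding (true  , false , true ) = refl
length-avoiding (true  , false , false) = refl
length-avoiding (false , true  , true ) = refl
length-avoiding (false , true  , false) = refl
length-avoiding (false , false , true ) = refl
length-avoiding (false , false , false) = refl

Lines3 : ℕ → Set
Lines3 a = Fin a × Fin a × Fin a

column : ∀ {a b} → (Fin a → Fin b → Bool) → Lines3 a → Fin b → Triple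
column e (i , j , k) l = e i l , e j l , e k l

Distinct : ∀ {a} → Lines3 a → Set
Distinct (i , j , k) = Distinct3 i j k

distinct? : ∀ {a} (ijk : Lines3 a) → Dec (Distinct ijk)
distinct? (i , j , k) = ¬? (i ≟ j) ×-dec ¬? (j ≟ k) ×-dec ¬? (i ≟ k)

Unshattered : ∀ {a b} → (Fin a → Fin b → Bool) → Set
Unshattered e = ∃ λ i → ∃ λ j → ∃ λ k → Distinct3 i j k × ∃ λ p → ∀ l → ¬ Meets p (column e (i , j , k) l)

∃-triple? : ∀ {p} {P : Pred Triple p} → Decidable P → Dec (∃ P)
∃-triple? P? = map′ (λ found → let t , _ , Pt = find found in t , Pt) (λ (t , Pt) → lose (∈-triples t) Pt)
  (Any.any? P? triples)

unshattered? : ∀ {a b} (e : Fin a → Fin b → Bool) → Dec (Unshattered e)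
unshattered? e = any? λ i → any? λ j → any? λ k → distinct? (i , j , k) ×-dec
  ∃-triple? λ p → all? λ l → ¬? (meets? p (column e (i , j , k) l))

¬shattered⇒unshattered : ∀ {a b} {e : Fin a → Fin b → Bool} → ¬ ThreeShattered e → Unshattered e
¬shattered⇒unshattered {e = e} ¬shattered with unshattered? e
... | yes unshattered = unshattered
... | no ¬unshattered = contradiction shattered ¬shattered
  where
  shattered : ThreeShattered e
  shattered i j k ijk x y z with any? (λ l → meets? (x , y , z) (column e (i , j , k) l))
  ... | yes met = met
  ... | no ¬met = contradiction (i , j , k , ijk , (x , y , z) , λ l m → ¬met (l , m)) ¬unshattered


unshatteredBound : ℕ → ℕ → ℕ
unshatteredBound m n = m * (m * m) * (8 * (6 ^ n * 2 ^ (n * (m ∸ 3))))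

module UnshatteredRows (m n : ℕ) where

  open import Data.List.Membership.DecPropositional {A = Fin m} _≟_ using (_∈?_)

  elements : Lines3 m → List (Fin m)
  elements (i , j , k) = i ∷ j ∷ k ∷ []

  outside : Lines3 m → List (Fin m)
  outside ijk = filter (λ r → ¬? (r ∈? elements ijk)) (allFin m)

  length-outside : ∀ {ijk} → Distinct ijk → length (outside ijk) ≤ m ∸ 3
  length-outside {i , j , k} (i≢j , j≢k , i≢k) = m+n≤o⇒m≤o∸n _ (begin
    length (outside (i , j , k)) + 3             ≤⟨ +-monoʳ-≤ _ three≤inside ⟩
    length (outside (i , j , k)) + length inside ≡⟨ length-filter-+-filter-¬ _ (allFin m) ⟩
    length (allFin m)                            ≡⟨ length-tabulate id ⟩
    m                                            ∎)
    where
    open ≤-Reasoning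
    inside = filter (λ r → ¬? (¬? (r ∈? elements (i , j , k)))) (allFin m)
    three≤inside : 3 ≤ length inside
    three≤inside = length-≤-by-injection _≡_ (λ { refl refl → refl })
      ((i≢j ∷ i≢k ∷ []) ∷ (j≢k ∷ []) ∷ [] ∷ [])
      λ {x} x∈ijk → x , ∈-filter⁺ (λ r → ¬? (¬? (r ∈? elements (i , j , k)))) (∈-allFin x) (λ x∉ijk → x∉ijk x∈ijk)
                      , refl

  Code : Set
  Code = Σ (Lines3 m) λ ijk → Triple × Vec Triple n × Vec (Vec Bool n) (length (outside ijk))

  Encodes : Matrix m n → Code → Set
  Encodes M (ijk , _ , w , rest) =
    (∀ l → lookup w l ≡ column (entry M) ijk l) ×
    (∀ x → lookup rest x ≡ lookup M (List.lookup (outside ijk) x))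

  encodes-injective : ∀ {M M′ c} → Encodes M c → Encodes M′ c → M ≡ M′
  encodes-injective {M} {M′} {(i , j , k) , _ , w , rest} (w≡ , rest≡) (w≡′ , rest≡′) = lookup-ext row
    where
    same-column : ∀ l → column (entry M) (i , j , k) l ≡ column (entry M′) (i , j , k) l
    same-column l = trans (sym (w≡ l)) (w≡′ l)
    row : ∀ r → lookup M r ≡ lookup M′ r
    row r with r ∈? elements (i , j , k)
    ... | yes (here refl)                 = lookup-ext λ l → cong proj₁ (same-column l)
    ... | yes (there (here refl))         = lookup-ext λ l → cong (proj₁ ∘ proj₂) (same-column l)
    ... | yes (there (there (here refl))) = lookup-ext λ l → cong (proj₂ ∘ proj₂) (same-column l)
    ... | no r∉ijk = begin
      lookup M r                                          ≡⟨ cong (lookup M) (lookup-index r∈) ⟩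
      lookup M (List.lookup (outside (i , j , k)) x)      ≡⟨ sym (rest≡ x) ⟩
      lookup rest x                                       ≡⟨ rest≡′ x ⟩
      lookup M′ (List.lookup (outside (i , j , k)) x)     ≡⟨ cong (lookup M′) (sym (lookup-index r∈)) ⟩
      lookup M′ r                                         ∎
      where
      open ≡-Reasoning
      r∈ = ∈-filter⁺ (λ r → ¬? (r ∈? elements (i , j , k))) (∈-allFin r) r∉ijk
      x = Any.index r∈

  codesAt : Lines3 m → Triple → List Code
  codesAt ijk p = map (λ (w , rest) → ijk , p , w , rest)
    (cartesianProduct (allVecs n (avoiding p)) (allVecs (length (outside ijk)) (allVecs n bits)))

  codesAtLines : Lines3 m → List Code
  codesAtLines ijk = concatMap (codesAt ijk) triples

  allLines : List (Lines3 m)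
  allLines = cartesianProduct (allFin m) (cartesianProduct (allFin m) (allFin m))

  distinctLines : List (Lines3 m)
  distinctLines = filter distinct? allLines

  codes : List Code
  codes = concatMap codesAtLines distinctLines

  encoding : ∀ {M} → Unshattered (entry M) → ∃ λ c → c ∈ codes × Encodes M c
  encoding {M} (i , j , k , ijk , p , avoids) = code , code∈codes , lookup∘tabulate _ , lookup∘tabulate _
    where
    w = tabulate (column (entry M) (i , j , k))
    rest = tabulate (λ x → lookup M (List.lookup (outside (i , j , k)) x))
    code : Code
    code = (i , j , k) , p , w , rest
    w∈ : w ∈ allVecs n (avoiding p)
    w∈ = ∈-allVecs w λ l → subst (_∈ avoiding p) (sym (lookup∘tabulate _ l))
      (∈-filter⁺ (¬? ∘ meets? p) (∈-triples _) (avoids l))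
    rest∈ : rest ∈ allVecs _ (allVecs n bits)
    rest∈ = ∈-allVecs rest λ x → ∈-allVecs _ λ l → ∈-bits _
    code∈codes : code ∈ codes
    code∈codes = ∈-concatMap⁺′ codesAtLines
      (∈-filter⁺ distinct? (∈-cartesianProduct⁺ (∈-allFin i) (∈-cartesianProduct⁺ (∈-allFin j) (∈-allFin k))) ijk)
      (∈-concatMap⁺′ (codesAt (i , j , k)) (∈-triples p) (∈-map⁺ _ (∈-cartesianProduct⁺ w∈ rest∈)))

  length-codes : length codes ≤ unshatteredBound m n
  length-codes = begin
    length codes                                          ≤⟨ length-concatMap-≤ codesAtLines distinctLines bound-lines ⟩
    length distinctLines * (8 * (6 ^ n * 2 ^ (n * (m ∸ 3)))) ≤⟨ *-monoˡ-≤ _ length-distinctLines ⟩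
    m * (m * m) * (8 * (6 ^ n * 2 ^ (n * (m ∸ 3))))       ∎
    where
    open ≤-Reasoning
    length-allFin : length (allFin m) ≡ m
    length-allFin = length-tabulate {n = m} id
    length-distinctLines : length distinctLines ≤ m * (m * m)
    length-distinctLines = ≤-trans (length-filter distinct? allLines) (≤-reflexive
      (trans (length-cartesianProductWith _,_ (allFin m) (cartesianProduct (allFin m) (allFin m)))
        (cong₂ _*_ length-allFin (trans (length-cartesianProductWith _,_ (allFin m) (allFin m))
          (cong₂ _*_ length-allFin length-allFin)))))
    bound-at : ∀ {ijk} p → Distinct ijk → length (codesAt ijk p) ≤ 6 ^ n * 2 ^ (n * (m ∸ 3))
    bound-at {ijk} p d = begin
      length (codesAt ijk p)                  ≡⟨ length-map _ (cartesianProduct ws rests) ⟩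
      length (cartesianProduct ws rests)      ≡⟨ length-cartesianProductWith _,_ ws rests ⟩
      length ws * length rests                ≡⟨ cong₂ _*_ length-ws length-rests ⟩
      6 ^ n * 2 ^ (n * L)                     ≤⟨ *-monoʳ-≤ (6 ^ n) (^-monoʳ-≤ 2 (*-monoʳ-≤ n (length-outside d))) ⟩
      6 ^ n * 2 ^ (n * (m ∸ 3))               ∎
      where
      L = length (outside ijk)
      ws = allVecs n (avoiding p)
      rests = allVecs L (allVecs n bits)
      length-ws : length ws ≡ 6 ^ n
      length-ws = trans (length-allVecs n _) (cong (_^ n) (length-avoiding p))
      length-rests : length rests ≡ 2 ^ (n * L)
      length-rests = trans (length-allVecs L _) (trans (cong (_^ L) (length-allVecs n bits)) (^-*-assoc 2 n L))
    bound-lines : ∀ {ijk} → ijk ∈ distinctLines → length (codesAtLines ijk) ≤ 8 * (6 ^ n * 2 ^ (n * (m ∸ 3)))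
    bound-lines {ijk} ijk∈ = length-concatMap-≤ (codesAt ijk) triples λ {p} _ →
      bound-at p (proj₂ (∈-filter⁻ distinct? {xs = allLines} ijk∈))

  unshattered-count : length (filter (unshattered? ∘ entry) (allMatrices m n)) ≤ unshatteredBound m n
  unshattered-count = ≤-trans
    (length-filter-≤-by-injection (unshattered? ∘ entry) Encodes
      (λ {M} {M′} {c} → encodes-injective {M} {M′} {c}) (allMatrices-unique m n) λ {M} _ → encoding {M})
    length-codes

transpose : ∀ {m n} → Matrix m n → Matrix n m
transpose M = tabulate λ l → tabulate λ i → entry M i l

entry-transpose : ∀ {m n} (M : Matrix m n) l i → entry (transpose M) l i ≡ entry M i l
entry-transpose M = entry-tabulate λ l i → entry M i l

transpose-injective : ∀ {m n} {M M′ : Matrix m n} → transpose M ≡ transpose M′ → M ≡ M′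
transpose-injective {M = M} {M′} same = entry-ext λ i l →
  trans (sym (entry-transpose M l i)) (trans (cong (λ N → entry N l i) same) (entry-transpose M′ l i))

Unshattered-resp : ∀ {a b} {e e′ : Fin a → Fin b → Bool} → (∀ i l → e i l ≡ e′ i l) → Unshattered e → Unshattered e′
Unshattered-resp e≗e′ (i , j , k , ijk , p , avoids) = i , j , k , ijk , p , λ l meets →
  avoids l (subst (Meets p) (cong₂ _,_ (sym (e≗e′ i l)) (cong₂ _,_ (sym (e≗e′ j l)) (sym (e≗e′ k l)))) meets)

unshattered-columns-count : ∀ m n →
  length (filter (λ M → unshattered? (λ l i → entry M i l)) (allMatrices m n)) ≤ unshatteredBound n m
unshattered-columns-count m n = ≤-trans
  (length-filter-≤-by-injection _ (λ M N → N ≡ transpose M) (λ { refl same → transpose-injective same })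
    (allMatrices-unique m n)
    λ {M} _ u → transpose M , ∈-filter⁺ (unshattered? ∘ entry) (∈-allMatrices _)
                                (Unshattered-resp (λ l i → sym (entry-transpose M l i)) u) , refl)
  (UnshatteredRows.unshattered-count n m)

¬shattered⇒rows⊎columns : ∀ {m n} {M : Matrix m n} → ¬ Shattered M →
  Unshattered (entry M) ⊎ Unshattered (λ l i → entry M i l)
¬shattered⇒rows⊎columns {M = M} ¬sh with threeShattered? (entry M)
... | yes rows = inj₂ (¬shattered⇒unshattered λ columns → ¬sh (rows , columns))
... | no ¬rows = inj₁ (¬shattered⇒unshattered ¬rows)

non-shattered-count : ∀ m n → 2 ^ (m * n) ∸ numShattered m n ≤ unshatteredBound m n + unshatteredBound n m
non-shattered-count m n = begin
  2 ^ (m * n) ∸ numShattered m n                    ≡⟨ cong (_∸ numShattered m n) (sym (length-allMatrices m n)) ⟩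
  length all ∸ numShattered m n                     ≡⟨ cong (_∸ numShattered m n) (sym (length-filter-+-filter-¬ shattered? all)) ⟩
  numShattered m n + length (filter (¬? ∘ shattered?) all) ∸ numShattered m n
                                                    ≡⟨ m+n∸m≡n (numShattered m n) _ ⟩
  length (filter (¬? ∘ shattered?) all)             ≤⟨ length-filter-≤-+ (¬? ∘ shattered?) (unshattered? ∘ entry) _
                                                         (λ {M} → ¬shattered⇒rows⊎columns {M = M}) all ⟩
  length (filter (unshattered? ∘ entry) all) + length (filter (λ M → unshattered? (λ l i → entry M i l)) all)
                                                    ≤⟨ +-mono-≤ (UnshatteredRows.unshattered-count m n) (unshattered-columns-count m n) ⟩
  unshatteredBound m n + unshatteredBound n m       ∎
  where
  open ≤-Reasoning
  all = allMatrices m n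

^-distribʳ-* : ∀ a b n → (a * b) ^ n ≡ a ^ n * b ^ n
^-distribʳ-* a b zero    = refl
^-distribʳ-* a b (suc n) = trans (cong (a * b *_) (^-distribʳ-* a b n)) ([m*n]*[o*p]≡[m*o]*[n*p] a b (a ^ n) (b ^ n))

n<2^n : ∀ n → n < 2 ^ n
n<2^n zero    = s≤s z≤n
n<2^n (suc n) = +-mono-≤ (m^n>0 2 n) (≤-trans (n<2^n n) (≤-reflexive (sym (+-identityʳ (2 ^ n)))))

^-cancelʳ-≤ : ∀ k .{{_ : NonZero k}} {a b} → a ^ k ≤ b ^ k → a ≤ b
^-cancelʳ-≤ k {a} {b} aᵏ≤bᵏ with a ≤? b
... | yes a≤b = a≤b
... | no  a≰b = contradiction aᵏ≤bᵏ (<⇒≱ (^-monoˡ-< k (≰⇒> a≰b)))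

^-comm : ∀ a m n → (a ^ m) ^ n ≡ (a ^ n) ^ m
^-comm a m n = trans (^-*-assoc a m n) (trans (cong (a ^_) (*-comm m n)) (sym (^-*-assoc a n m)))

-- In tenth powers the polynomial factors are absorbed: (A m³ 3ⁿ)¹⁰ ≤ 2ⁿ (2ⁿ)³ (3¹⁰)ⁿ and 3¹⁰ ≤ 2¹⁶.
cubic*3^n≤4^n : ∀ A m n → A ^ 10 ≤ n → m ^ 10 ≤ 2 ^ n → A * (m * (m * m)) * 3 ^ n ≤ 2 ^ n * 2 ^ n
cubic*3^n≤4^n A m n A¹⁰≤n m¹⁰≤2ⁿ = ^-cancelʳ-≤ 10 (begin
  (A * (m * (m * m)) * 3 ^ n) ^ 10                   ≡⟨ solve 3 (λ A m Q → (A :* (m :* (m :* m)) :* Q) :^ 10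
                                                         := A :^ 10 :* (m :^ 10 :* (m :^ 10 :* m :^ 10)) :* Q :^ 10) refl A m (3 ^ n) ⟩
  A ^ 10 * (m ^ 10 * (m ^ 10 * m ^ 10)) * (3 ^ n) ^ 10 ≤⟨ *-mono-≤ (*-mono-≤ A¹⁰≤2ⁿ (*-mono-≤ m¹⁰≤2ⁿ (*-mono-≤ m¹⁰≤2ⁿ m¹⁰≤2ⁿ)))
                                                                  3ⁿ¹⁰≤2ⁿ¹⁶ ⟩
  P * (P * (P * P)) * P ^ 16                         ≡⟨ solve 1 (λ P → P :* (P :* (P :* P)) :* P :^ 16 := (P :* P) :^ 10) refl P ⟩
  (P * P) ^ 10                                       ∎)
  where
  open ≤-Reasoning
  P = 2 ^ n
  A¹⁰≤2ⁿ : A ^ 10 ≤ P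
  A¹⁰≤2ⁿ = ≤-trans A¹⁰≤n (<⇒≤ (n<2^n n))
  3ⁿ¹⁰≤2ⁿ¹⁶ : (3 ^ n) ^ 10 ≤ P ^ 16
  3ⁿ¹⁰≤2ⁿ¹⁶ = begin
    (3 ^ n) ^ 10 ≡⟨ ^-comm 3 n 10 ⟩
    (3 ^ 10) ^ n ≤⟨ ^-monoˡ-≤ n (toWitness {a? = 3 ^ 10 ≤? 2 ^ 16} _) ⟩
    (2 ^ 16) ^ n ≡⟨ ^-comm 2 16 n ⟩
    P ^ 16       ∎

unshatteredBound-negligible : ∀ K m n → 3 ≤ m → (16 * K) ^ 10 ≤ n → m ^ 10 ≤ 2 ^ n →
  2 * K * unshatteredBound m n ≤ 2 ^ (m * n)
unshatteredBound-negligible K m@(suc (suc (suc m′))) n (s≤s (s≤s (s≤s _))) A¹⁰≤n m¹⁰≤2ⁿ = begin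
  2 * K * (m * (m * m) * (8 * (6 ^ n * R)))    ≡⟨ cong (λ x → 2 * K * (m * (m * m) * (8 * (x * R)))) (^-distribʳ-* 3 2 n) ⟩
  2 * K * (m * (m * m) * (8 * (3 ^ n * P * R))) ≡⟨ solve 5 (λ K m Q P R → con 2 :* K :* (m :* (m :* m) :* (con 8 :* (Q :* P :* R)))
                                                    := con 16 :* K :* (m :* (m :* m)) :* Q :* (P :* R)) refl K m (3 ^ n) P R ⟩
  16 * K * (m * (m * m)) * 3 ^ n * (P * R)      ≤⟨ *-monoˡ-≤ (P * R) (cubic*3^n≤4^n (16 * K) m n A¹⁰≤n m¹⁰≤2ⁿ) ⟩
  P * P * (P * R)                               ≡⟨ solve 2 (λ P R → P :* P :* (P :* R) := P :^ 3 :* R) refl P R ⟩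
  P ^ 3 * R                                     ≡⟨ cong (_* R) (^-*-assoc 2 n 3) ⟩
  2 ^ (n * 3) * R                               ≡⟨ sym (^-distribˡ-+-* 2 (n * 3) (n * m′)) ⟩
  2 ^ (n * 3 + n * m′)                          ≡⟨ cong (2 ^_) (solve 2 (λ m′ n → n :* con 3 :+ n :* m′ := (con 3 :+ m′) :* n) refl m′ n) ⟩
  2 ^ (m * n)                                   ∎
  where
  open ≤-Reasoning
  P = 2 ^ n
  R = 2 ^ (n * m′)

shattered-proportion : ∀ k m n → (16 * suc k) ^ 10 + 3 ≤ m → (16 * suc k) ^ 10 + 3 ≤ n →
  n ^ 10 ≤ 2 ^ m → m ^ 10 ≤ 2 ^ n → suc k * (2 ^ (m * n) ∸ numShattered m n) ≤ 2 ^ (m * n)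
shattered-proportion k m n N≤m N≤n n¹⁰≤2ᵐ m¹⁰≤2ⁿ = *-cancelˡ-≤ 2 (begin
  2 * (K * (2 ^ (m * n) ∸ numShattered m n))                ≤⟨ *-monoʳ-≤ 2 (*-monoʳ-≤ K (non-shattered-count m n)) ⟩
  2 * (K * (unshatteredBound m n + unshatteredBound n m))   ≡⟨ solve 3 (λ K x y → con 2 :* (K :* (x :+ y)) := con 2 :* K :* x :+ con 2 :* K :* y)
                                                                  refl K (unshatteredBound m n) (unshatteredBound n m) ⟩
  2 * K * unshatteredBound m n + 2 * K * unshatteredBound n m
      ≤⟨ +-mono-≤ (unshatteredBound-negligible K m n (3≤ N≤m) (A≤ N≤n) m¹⁰≤2ⁿ)
                  (≤-trans (unshatteredBound-negligible K n m (3≤ N≤n) (A≤ N≤m) n¹⁰≤2ᵐ) (≤-reflexive (cong (2 ^_) (*-comm n m)))) ⟩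
  2 ^ (m * n) + 2 ^ (m * n)                                 ≡⟨ solve 1 (λ x → x :+ x := con 2 :* x) refl (2 ^ (m * n)) ⟩
  2 * 2 ^ (m * n)                                           ∎)
  where
  open ≤-Reasoning
  K = suc k
  3≤ : ∀ {x} → (16 * K) ^ 10 + 3 ≤ x → 3 ≤ x
  3≤ = ≤-trans (m≤n+m 3 ((16 * K) ^ 10))
  A≤ : ∀ {x} → (16 * K) ^ 10 + 3 ≤ x → (16 * K) ^ 10 ≤ x
  A≤ = ≤-trans (m≤m+n _ 3)

fresh : ∀ {n} → 3 ≤ n → (i j : Fin n) → ∃ λ k → k ≢ i × k ≢ j
fresh (s≤s (s≤s (s≤s _))) i j with zero ≟ i | zero ≟ j
... | no 0≢i | no 0≢j = zero , 0≢i , 0≢j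
... | yes refl | _ with suc zero ≟ j
...   | no 1≢j   = suc zero , (λ ()) , 1≢j
...   | yes refl = suc (suc zero) , (λ ()) , (λ ())
fresh (s≤s (s≤s (s≤s _))) i j | no 0≢i | yes refl with suc zero ≟ i
...   | no 1≢i   = suc zero , 1≢i , (λ ())
...   | yes refl = suc (suc zero) , (λ ()) , (λ ())

xor≡true⇒≡not : ∀ s s′ → s xor s′ ≡ true → s′ ≡ not s
xor≡true⇒≡not true  false refl = refl
xor≡true⇒≡not false true  refl = refl

flip-left : ∀ x s t → x xor not s xor t ≡ not (x xor s xor t)
flip-left x s t = trans (cong (x xor_) (sym (not-distribˡ-xor s t))) (sym (not-distribʳ-xor x (s xor t)))

flip-right : ∀ x s t → x xor s xor not t ≡ not (x xor s xor t)
flip-right x s t = trans (cong (x xor_) (sym (not-distribʳ-xor s t))) (sym (not-distribʳ-xor x (s xor t)))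

sign-for : ∀ x t b → ∃ λ s → x xor s xor t ≡ b
sign-for true  true  true  = true  , refl
sign-for true  true  false = false , refl
sign-for true  false true  = false , refl
sign-for true  false false = true  , refl
sign-for false true  true  = false , refl
sign-for false true  false = true  , refl
sign-for false false true  = true  , refl
sign-for false false false = false , refl

xor-cancel : ∀ t s b → (t xor s xor b) xor s xor t ≡ b
xor-cancel true  true  true  = refl
xor-cancel true  true  false = refl
xor-cancel true  false true  = refl
xor-cancel true  false false = refl
xor-cancel false true  true  = refl
xor-cancel false true  false = refl
xor-cancel false false true  = refl
xor-cancel false false false = refl

xor-injectiveˡ : ∀ t t′ g → t xor g ≡ t′ xor g → t ≡ t′
xor-injectiveˡ true  true  _ _  = refl
xor-injectiveˡ false false _ _  = refl
xor-injectiveˡ true  false g eq = contradiction (sym eq) (not-¬ refl)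
xor-injectiveˡ false true  g eq = contradiction eq (not-¬ refl)

xor-false≢xor-true : ∀ t → t xor false ≢ t xor true
xor-false≢xor-true true  ()
xor-false≢xor-true false ()

≡-or-≡not : ∀ s s′ → s′ ≡ s ⊎ s′ ≡ not s
≡-or-≡not true  true  = inj₁ refl
≡-or-≡not true  false = inj₂ refl
≡-or-≡not false true  = inj₂ refl
≡-or-≡not false false = inj₁ refl

-- Two compatible constraints on one row ask for the same column pattern, unless they forbid both ends of a matching edge.
same-row-targets : ∀ s s′ b b′ → (s ≡ s′ → b ≡ b′) → (b ≡ true → b′ ≡ true → s xor s′ ≡ false) →
  s xor b ≡ s′ xor b′ ⊎ (s′ ≡ not s × b ≡ false × b′ ≡ false)
same-row-targets true  true  _     _     consistent _ = inj₁ (cong (true xor_) (consistent refl))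
same-row-targets false false _     _     consistent _ = inj₁ (cong (false xor_) (consistent refl))
same-row-targets true  false true  true  _ independent with () ← independent refl refl
same-row-targets false true  true  true  _ independent with () ← independent refl refl
same-row-targets true  false true  false _ _ = inj₁ refl
same-row-targets true  false false true  _ _ = inj₁ refl
same-row-targets false true  true  false _ _ = inj₁ refl
same-row-targets false true  false true  _ _ = inj₁ refl
same-row-targets true  false false false _ _ = inj₂ (refl , refl , refl)
same-row-targets false true  false false _ _ = inj₂ (refl , refl , refl)

triple-injective : ∀ {a x : A} {b y : B} {c z : C} → (a , b , c) ≡ (x , y , z) → a ≡ x × b ≡ y × c ≡ z
triple-injective eq = let a≡x , bc≡yz = ,-injective eq in a≡x , ,-injective bc≡yz

matching : ∀ {k} → Fin k → Bool → Fin k → Bool → Bool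
matching i s j s′ = does (i ≟ j) ∧ (s xor s′)

module _ {k} (i : Fin k) (s : Bool) (j : Fin k) (s′ : Bool) where

  matching-≢ : i ≢ j → matching i s j s′ ≡ false
  matching-≢ i≢j = cong (_∧ (s xor s′)) (dec-false (i ≟ j) i≢j)

  matching-sym : matching i s j s′ ≡ matching j s′ i s
  matching-sym with i ≟ j | j ≟ i
  ... | yes _    | yes _    = xor-comm s s′
  ... | no _     | no _     = refl
  ... | yes refl | no i≢i   = contradiction refl i≢i
  ... | no i≢i   | yes refl = contradiction refl i≢i

  matching≡true : matching i s j s′ ≡ true → i ≡ j × s′ ≡ not s
  matching≡true with i ≟ j
  ... | yes i≡j = λ s⊕s′ → i≡j , xor≡true⇒≡not s s′ s⊕s′
  ... | no _    = λ ()

matching-self : ∀ {k} (i : Fin k) s s′ → matching i s i s′ ≡ s xor s′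
matching-self i s s′ = cong (_∧ (s xor s′)) (dec-true (i ≟ i) refl)

Vertex : ℕ → ℕ → Set
Vertex r c = (Fin r × Bool) ⊎ (Fin c × Bool)

pattern row i s = inj₁ (i , s)
pattern col l t = inj₂ (l , t)

module MatrixGraph {r c : ℕ} (e : Fin r → Fin c → Bool) where

  adjacent : Vertex r c → Vertex r c → Bool
  adjacent (row i s) (row j s′) = matching i s j s′
  adjacent (col l t) (col l′ t′) = matching l t l′ t′
  adjacent (row i s) (col l t)  = e i l xor s xor t
  adjacent (col l t) (row i s)  = e i l xor s xor t

  adjacent-irreflexive : ∀ v → adjacent v v ≡ false
  adjacent-irreflexive (row i s) = trans (matching-self i s s) (xor-same s)
  adjacent-irreflexive (col l t) = trans (matching-self l t t) (xor-same t)

  adjacent-sym : ∀ u v → adjacent u v ≡ adjacent v u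
  adjacent-sym (row i s) (row j s′) = matching-sym i s j s′
  adjacent-sym (col l t) (col l′ t′) = matching-sym l t l′ t′
  adjacent-sym (row _ _) (col _ _) = refl
  adjacent-sym (col _ _) (row _ _) = refl

  -- Flipping the sign of one end of a matching edge complements its adjacency to the other side.
  no-common-neighbour : ∀ i s j s′ l t → matching i s j s′ ≡ true →
    e i l xor s xor t ≡ true → e j l xor s′ xor t ≡ true → ⊥
  no-common-neighbour i s j s′ l t i~j i~lt j~lt with matching≡true i s j s′ i~j
  ... | refl , refl with () ← trans (sym j~lt) (trans (flip-left (e i l) s t) (cong not i~lt))

  no-common-neighbourᵀ : ∀ l t l′ t′ i s → matching l t l′ t′ ≡ true →
    e i l xor s xor t ≡ true → e i l′ xor s xor t′ ≡ true → ⊥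
  no-common-neighbourᵀ l t l′ t′ i s l~l′ i~lt i~l′t′ with matching≡true l t l′ t′ l~l′
  ... | refl , refl with () ← trans (sym i~l′t′) (trans (flip-right (e i l) s t) (cong not i~lt))

  triangle-free : ∀ u v w → adjacent u v ≡ true → adjacent v w ≡ true → adjacent u w ≡ true → ⊥
  triangle-free (row i s) (row j s′) (row k s″) uv vw uw
    with matching≡true i s j s′ uv | matching≡true j s′ k s″ vw | matching≡true i s k s″ uw
  ... | refl , refl | refl , refl | _ , s″≡not-s = not-¬ refl (sym s″≡not-s)
  triangle-free (row i s) (row j s′) (col l t) uv vw uw = no-common-neighbour i s j s′ l t uv uw vw
  triangle-free (row i s) (col l t) (row j s′) uv vw uw = no-common-neighbour i s j s′ l t uw uv vw
  triangle-free (col l t) (row i s) (row j s′) uv vw uw = no-common-neighbour i s j s′ l t vw uv uw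
  triangle-free (col l t) (col l′ t′) (row i s) uv vw uw = no-common-neighbourᵀ l t l′ t′ i s uv uw vw
  triangle-free (col l t) (row i s) (col l′ t′) uv vw uw = no-common-neighbourᵀ l t l′ t′ i s uw uv vw
  triangle-free (row i s) (col l t) (col l′ t′) uv vw uw = no-common-neighbourᵀ l t l′ t′ i s vw uv uw
  triangle-free (col l t) (col l′ t′) (col l″ t″) uv vw uw
    with matching≡true l t l′ t′ uv | matching≡true l′ t′ l″ t″ vw | matching≡true l t l″ t″ uw
  ... | refl , refl | refl , refl | _ , t″≡not-t = not-¬ refl (sym t″≡not-t)

  Constraint : Set
  Constraint = Vertex r c × Bool

  record _satisfies_ (v : Vertex r c) (x : Constraint) : Set where
    constructor satisfying
    field
      distinct  : v ≢ proj₁ x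
      adjacency : adjacent v (proj₁ x) ≡ proj₂ x

  record Compatible (x y : Constraint) : Set where
    constructor compatible
    field
      consistent  : proj₁ x ≡ proj₁ y → proj₂ x ≡ proj₂ y
      independent : proj₂ x ≡ true → proj₂ y ≡ true → adjacent (proj₁ x) (proj₁ y) ≡ false

  compatible-sym : ∀ {x y} → Compatible x y → Compatible y x
  compatible-sym {x , _} {y , _} (compatible consistent independent) =
    compatible (λ y≡x → sym (consistent (sym y≡x))) (λ b′ b → trans (adjacent-sym y x) (independent b b′))

  Compatible₃ : Constraint → Constraint → Constraint → Set
  Compatible₃ x y z = Compatible x y × Compatible y z × Compatible x z

  Extends : Constraint → Constraint → Constraint → Set
  Extends x y z = ∃ λ v → v satisfies x × v satisfies y × v satisfies z

  module _ {x y z : Constraint} where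

    compatible₃-swap₁₂ : Compatible₃ x y z → Compatible₃ y x z
    compatible₃-swap₁₂ (xy , yz , xz) = compatible-sym xy , xz , yz

    compatible₃-swap₂₃ : Compatible₃ x y z → Compatible₃ x z y
    compatible₃-swap₂₃ (xy , yz , xz) = xz , compatible-sym yz , xy

    extends-swap₁₂ : Extends y x z → Extends x y z
    extends-swap₁₂ (v , vy , vx , vz) = v , vx , vy , vz

    extends-swap₂₃ : Extends x z y → Extends x y z
    extends-swap₂₃ (v , vx , vz , vy) = v , vx , vy , vz

  row-partner : ∀ i s → row i (not s) satisfies (row i s , true)
  row-partner i s = satisfying (λ eq → not-¬ refl (sym (proj₂ (,-injective (inj₁-injective eq)))))
                               (trans (matching-self i (not s) s) (xor-inverseˡ s))

  col-partner : ∀ l t → col l (not t) satisfies (col l t , true)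
  col-partner l t = satisfying (λ eq → not-¬ refl (sym (proj₂ (,-injective (inj₂-injective eq)))))
                               (trans (matching-self l (not t) t) (xor-inverseˡ t))

  other-row : ∀ {k i} s′ s → k ≢ i → row k s′ satisfies (row i s , false)
  other-row s′ s k≢i = satisfying (λ { refl → k≢i refl }) (matching-≢ _ s′ _ s k≢i)

module RowExtension {r c : ℕ} (e : Fin r → Fin c → Bool) (3≤r : 3 ≤ r) (shattered : ThreeShattered e) where
  open MatrixGraph e

  realise-distinct : ∀ {i j k} → Distinct3 i j k → ∀ g g′ g″ →
    ∃ λ l → ∃ λ t → e i l ≡ t xor g × e j l ≡ t xor g′ × e k l ≡ t xor g″
  realise-distinct {i} {j} {k} ijk g g′ g″ with shattered i j k ijk g g′ g″
  ... | l , inj₁ same       = l , false , triple-injective same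
  ... | l , inj₂ complement = l , true , triple-injective complement

  realise₂ : ∀ i j g g′ → (i ≡ j → g ≡ g′) → ∃ λ l → ∃ λ t → e i l ≡ t xor g × e j l ≡ t xor g′
  realise₂ i j g g′ consistent with i ≟ j | fresh 3≤r i j
  ... | no i≢j | k , k≢i , k≢j with l , t , il , jl , _ ← realise-distinct (i≢j , k≢j ∘ sym , k≢i ∘ sym) g g′ false
      = l , t , il , jl
  ... | yes refl | k , k≢i , _ with k′ , k′≢i , k′≢k ← fresh 3≤r i k
      with l , t , il , _ ← realise-distinct (k≢i ∘ sym , k′≢k ∘ sym , k′≢i ∘ sym) g false false
      = l , t , il , trans il (cong (t xor_) (consistent refl))

  realise : ∀ i j k g g′ g″ → (i ≡ j → g ≡ g′) → (j ≡ k → g′ ≡ g″) → (i ≡ k → g ≡ g″) →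
    ∃ λ l → ∃ λ t → e i l ≡ t xor g × e j l ≡ t xor g′ × e k l ≡ t xor g″
  realise i j k g g′ g″ ij jk ik with i ≟ j | j ≟ k | i ≟ k
  ... | no i≢j | no j≢k | no i≢k = realise-distinct (i≢j , j≢k , i≢k) g g′ g″
  ... | yes refl | _ | _ with l , t , il , kl ← realise₂ i k g g″ ik
      = l , t , il , trans il (cong (t xor_) (ij refl)) , kl
  ... | no _ | yes refl | _ with l , t , il , jl ← realise₂ i j g g′ ij
      = l , t , il , jl , trans jl (cong (t xor_) (jk refl))
  ... | no _ | no _ | yes refl with l , t , il , jl ← realise₂ i j g g′ ij
      = l , t , il , jl , trans il (cong (t xor_) (ik refl))

  -- Asking a fresh third row for both values yields two columns, which cannot both be l₀.
  realise-avoiding : ∀ i j g g′ → (i ≡ j → g ≡ g′) → (l₀ : Fin c) →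
    ∃ λ l → ∃ λ t → l ≢ l₀ × e i l ≡ t xor g × e j l ≡ t xor g′
  realise-avoiding i j g g′ ij l₀
    with k , k≢i , k≢j ← fresh 3≤r i j
    with l₁ , t₁ , il₁ , jl₁ , kl₁ ← realise i j k g g′ false ij (flip contradiction k≢j ∘ sym) (flip contradiction k≢i ∘ sym)
       | l₂ , t₂ , il₂ , jl₂ , kl₂ ← realise i j k g g′ true ij (flip contradiction k≢j ∘ sym) (flip contradiction k≢i ∘ sym)
    with l₁ ≟ l₀ | l₂ ≟ l₀
  ... | no l₁≢l₀ | _        = l₁ , t₁ , l₁≢l₀ , il₁ , jl₁
  ... | yes refl | no l₂≢l₀ = l₂ , t₂ , l₂≢l₀ , il₂ , jl₂
  ... | yes refl | yes refl with refl ← xor-injectiveˡ t₁ t₂ g (trans (sym il₁) il₂)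
      = contradiction (trans (sym kl₁) kl₂) (xor-false≢xor-true t₁)

  col-satisfies-row : ∀ {l t i s b} → e i l ≡ t xor s xor b → col l t satisfies (row i s , b)
  col-satisfies-row {l} {t} {i} {s} {b} eil = satisfying (λ ()) (trans (cong (λ x → x xor s xor t) eil) (xor-cancel t s b))

  row-pair : ∀ {i s b j s′ b′} → Compatible (row i s , b) (row j s′ , b′) →
    (i ≡ j → s xor b ≡ s′ xor b′) ⊎ (j ≡ i × s′ ≡ not s × b ≡ false × b′ ≡ false)
  row-pair {i} {s} {b} {j} {s′} {b′} (compatible consistent independent) with i ≟ j
  ... | no i≢j = inj₁ (flip contradiction i≢j)
  ... | yes refl with same-row-targets s s′ b b′ (λ { refl → consistent refl }) independent
  ...   | inj₁ same-target = inj₁ λ _ → same-target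
  ...   | inj₂ antipodal   = inj₂ (refl , antipodal)

  antipodal-extends : ∀ {i s} z → Compatible (row i s , false) z → Compatible (row i (not s) , false) z →
    Extends (row i s , false) (row i (not s) , false) z
  antipodal-extends {i} {s} (row j s″ , false) _ _ with k , k≢i , k≢j ← fresh 3≤r i j =
    row k true , other-row true s k≢i , other-row true (not s) k≢i , other-row true s″ k≢j
  antipodal-extends {i} {s} (row j s″ , true) xz yz with j ≟ i
  ... | no j≢i = row j (not s″) , other-row (not s″) s j≢i , other-row (not s″) (not s) j≢i , row-partner j s″
  ... | yes refl with ≡-or-≡not s s″
  ...   | inj₁ refl with () ← Compatible.consistent xz refl
  ...   | inj₂ refl with () ← Compatible.consistent yz refl
  antipodal-extends {i} {s} (col l t , b) _ _
    with k , k≢i , _ ← fresh 3≤r i i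
    with s′ , kl≡b ← sign-for (e k l) t b
    = row k s′ , other-row s′ s k≢i , other-row s′ (not s) k≢i , satisfying (λ ()) kl≡b

  extends-three-rows : ∀ {i s b j s′ b′ k s″ b″} → Compatible₃ (row i s , b) (row j s′ , b′) (row k s″ , b″) →
    Extends (row i s , b) (row j s′ , b′) (row k s″ , b″)
  extends-three-rows {i} {s} {b} {j} {s′} {b′} {k} {s″} {b″} (xy , yz , xz)
    with row-pair xy | row-pair yz | row-pair xz
  ... | inj₂ (refl , refl , refl , refl) | _ | _ = antipodal-extends _ xz yz
  ... | inj₁ _ | inj₂ (refl , refl , refl , refl) | _ =
    extends-swap₁₂ (extends-swap₂₃ (antipodal-extends _ (compatible-sym xy) (compatible-sym xz)))
  ... | inj₁ _ | inj₁ _ | inj₂ (refl , refl , refl , refl) = extends-swap₂₃ (antipodal-extends _ xy (compatible-sym yz))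
  ... | inj₁ ij | inj₁ jk | inj₁ ik
    with l , t , il , jl , kl ← realise i j k (s xor b) (s′ xor b′) (s″ xor b″) ij jk ik
    = col l t , col-satisfies-row il , col-satisfies-row jl , col-satisfies-row kl

  extends-rows-non-neighbour : ∀ {i s b j s′ b′ l₀ t₀} → Compatible₃ (row i s , b) (row j s′ , b′) (col l₀ t₀ , false) →
    Extends (row i s , b) (row j s′ , b′) (col l₀ t₀ , false)
  extends-rows-non-neighbour {i} {s} {b} {j} {s′} {b′} {l₀} {t₀} (xy , yz , xz) with row-pair xy
  ... | inj₂ (refl , refl , refl , refl) = antipodal-extends _ xz yz
  ... | inj₁ ij with l , t , l≢l₀ , il , jl ← realise-avoiding i j (s xor b) (s′ xor b′) ij l₀
    = col l t , col-satisfies-row il , col-satisfies-row jl ,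
      satisfying (λ { refl → l≢l₀ refl }) (matching-≢ l t l₀ t₀ l≢l₀)

  flipped-col-satisfies : ∀ {l t i s b} → e i l xor s xor t ≡ not b → col l (not t) satisfies (row i s , b)
  flipped-col-satisfies {l} {t} {i} {s} {b} il≡¬b =
    satisfying (λ ()) (trans (flip-right (e i l) s t) (trans (cong not il≡¬b) (not-involutive b)))

  flipped-col-or-escape : ∀ {i s b l t} → Compatible (row i s , b) (col l t , true) →
    e i l xor s xor t ≡ not b ⊎ (b ≡ false × e i l xor s xor t ≡ false)
  flipped-col-or-escape {b = true} xz = inj₁ (Compatible.independent xz refl refl)
  flipped-col-or-escape {i} {s} {false} {l} {t} _ with e i l xor s xor t
  ... | true  = inj₁ refl
  ... | false = inj₂ (refl , refl)

  -- Here col l (not t) fails the first constraint: use the partner of the second row vertex, or a fresh row.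
  escape : ∀ {i s j s′ b′ l t} → Compatible (row i s , false) (row j s′ , b′) → Compatible (row j s′ , b′) (col l t , true) →
    e i l xor s xor t ≡ false → Extends (row i s , false) (row j s′ , b′) (col l t , true)
  escape {i} {s} {j} {s′} {true} {l} {t} xy yz il≡false with j ≟ i
  ... | no j≢i = row j (not s′) , other-row (not s′) s j≢i , row-partner j s′ ,
    satisfying (λ ()) (trans (flip-left (e j l) s′ t) (cong not (Compatible.independent yz refl refl)))
  ... | yes refl with ≡-or-≡not s s′
  ...   | inj₁ refl with () ← Compatible.consistent xy refl
  ...   | inj₂ refl with () ← trans (sym (Compatible.independent yz refl refl))
                                    (trans (flip-left (e i l) s t) (cong not il≡false))
  escape {i} {s} {j} {s′} {false} {l} {t} _ _ _
    with k , k≢i , k≢j ← fresh 3≤r i j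
    with s″ , kl≡true ← sign-for (e k l) t true
    = row k s″ , other-row s″ s k≢i , other-row s″ s′ k≢j , satisfying (λ ()) kl≡true

  extends-rows-neighbour : ∀ {i s b j s′ b′ l t} → Compatible₃ (row i s , b) (row j s′ , b′) (col l t , true) →
    Extends (row i s , b) (row j s′ , b′) (col l t , true)
  extends-rows-neighbour {l = l} {t} (xy , yz , xz) with flipped-col-or-escape xz | flipped-col-or-escape yz
  ... | inj₁ x✓ | inj₁ y✓ = col l (not t) , flipped-col-satisfies x✓ , flipped-col-satisfies y✓ , col-partner l t
  ... | inj₂ (refl , x✗) | _ = escape xy yz x✗
  ... | inj₁ _ | inj₂ (refl , y✗) = extends-swap₁₂ (escape (compatible-sym xy) xz y✗)

  extends-rows : ∀ {i s b j s′ b′} z → Compatible₃ (row i s , b) (row j s′ , b′) z →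
    Extends (row i s , b) (row j s′ , b′) z
  extends-rows (row _ _ , _)     = extends-three-rows
  extends-rows (col _ _ , false) = extends-rows-non-neighbour
  extends-rows (col _ _ , true)  = extends-rows-neighbour

module Extension {r c : ℕ} (e : Fin r → Fin c → Bool) (3≤r : 3 ≤ r) (3≤c : 3 ≤ c)
                 (rows-shattered : ThreeShattered e) (columns-shattered : ThreeShattered (λ l i → e i l)) where
  open MatrixGraph e
  private module ᵀ = MatrixGraph (λ l i → e i l)
  open RowExtension e 3≤r rows-shattered using (extends-rows)
  open RowExtension (λ l i → e i l) 3≤c columns-shattered using () renaming (extends-rows to extends-columns)

  adjacent-swap : ∀ u v → ᵀ.adjacent (swap u) (swap v) ≡ adjacent u v
  adjacent-swap (row _ _) (row _ _) = refl
  adjacent-swap (col _ _) (col _ _) = refl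
  adjacent-swap (row i s) (col l t) = cong (e i l xor_) (xor-comm t s)
  adjacent-swap (col l t) (row i s) = cong (e i l xor_) (xor-comm t s)

  swapᶜ : Constraint → ᵀ.Constraint
  swapᶜ (x , b) = swap x , b

  compatible-swap : ∀ {x y} → Compatible x y → ᵀ.Compatible (swapᶜ x) (swapᶜ y)
  compatible-swap {x , _} {y , _} (compatible consistent independent) =
    ᵀ.compatible (consistent ∘ swap-injective) (λ b b′ → trans (adjacent-swap x y) (independent b b′))
    where
    swap-injective : ∀ {u v : Vertex r c} → swap u ≡ swap v → u ≡ v
    swap-injective {u} {v} eq = trans (sym (swap-involutive u)) (trans (cong swap eq) (swap-involutive v))

  satisfies-swap : ∀ {v x} → v ᵀ.satisfies swapᶜ x → swap v satisfies x
  satisfies-swap {v} {x , _} (ᵀ.satisfying v≢x adjacency) = satisfying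
    (λ eq → v≢x (trans (sym (swap-involutive v)) (cong swap eq)))
    (trans (sym (adjacent-swap (swap v) x)) (trans (cong (λ w → ᵀ.adjacent w (swap x)) (swap-involutive v)) adjacency))

  extends-two-columns : ∀ {l t b l′ t′ b′} z → Compatible₃ (col l t , b) (col l′ t′ , b′) z →
    Extends (col l t , b) (col l′ t′ , b′) z
  extends-two-columns z (xy , yz , xz)
    with v , vx , vy , vz ← extends-columns (swapᶜ z) (compatible-swap xy , compatible-swap yz , compatible-swap xz)
    = swap v , satisfies-swap vx , satisfies-swap vy , satisfies-swap vz

  extension : ∀ x y z → Compatible₃ x y z → Extends x y z
  extension (row _ _ , _) (row _ _ , _) z ok = extends-rows z ok
  extension (col _ _ , _) (col _ _ , _) z ok = extends-two-columns z ok
  extension (row _ _ , _) y (row _ _ , _) ok = extends-swap₂₃ (extends-rows y (compatible₃-swap₂₃ ok))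
  extension (col _ _ , _) y (col _ _ , _) ok = extends-swap₂₃ (extends-two-columns y (compatible₃-swap₂₃ ok))
  extension x (row _ _ , _) (row _ _ , _) ok =
    extends-swap₁₂ (extends-swap₂₃ (extends-rows x (compatible₃-swap₂₃ (compatible₃-swap₁₂ ok))))
  extension x (col _ _ , _) (col _ _ , _) ok =
    extends-swap₁₂ (extends-swap₂₃ (extends-two-columns x (compatible₃-swap₂₃ (compatible₃-swap₁₂ ok))))

  compatible₃-∈ : ∀ {cs x y z} → (∀ {x y} → x ∈ cs → y ∈ cs → Compatible x y) →
    x ∈ cs → y ∈ cs → z ∈ cs → Compatible₃ x y z
  compatible₃-∈ ok x∈ y∈ z∈ = ok x∈ y∈ , ok y∈ z∈ , ok x∈ z∈

  extension-list : ∀ cs → length cs ≤ 3 → (∀ {x y} → x ∈ cs → y ∈ cs → Compatible x y) →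
    ∃ λ v → ∀ {x} → x ∈ cs → v satisfies x
  extension-list [] _ _ = row (fromℕ< (≤-trans (s≤s z≤n) 3≤r)) true , λ ()
  extension-list (x ∷ []) _ ok
    with v , vx , _ ← extension x x x (compatible₃-∈ ok (here refl) (here refl) (here refl))
    = v , λ { (here refl) → vx }
  extension-list (x ∷ y ∷ []) _ ok
    with v , vx , vy , _ ← extension x y y (compatible₃-∈ ok (here refl) (there (here refl)) (there (here refl)))
    = v , λ { (here refl) → vx ; (there (here refl)) → vy }
  extension-list (x ∷ y ∷ z ∷ []) _ ok
    with v , vx , vy , vz ← extension x y z (compatible₃-∈ ok (here refl) (there (here refl)) (there (there (here refl))))
    = v , λ { (here refl) → vx ; (there (here refl)) → vy ; (there (there (here refl))) → vz }
  extension-list (_ ∷ _ ∷ _ ∷ _ ∷ _) (s≤s (s≤s (s≤s ())))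



⊎-self↔×Bool : ∀ {A : Set} → (A ⊎ A) ↔ (A × Bool)
⊎-self↔×Bool = mk↔ₛ′ [ (_, true) , (_, false) ]′ from (λ { (_ , true) → refl ; (_ , false) → refl })
                      (λ { (inj₁ _) → refl ; (inj₂ _) → refl })
  where
  from : ∀ {A : Set} → A × Bool → A ⊎ A
  from (a , true)  = inj₁ a
  from (a , false) = inj₂ a

vertices↔ : ∀ {r c} → Fin ((r + r) + (c + c)) ↔ Vertex r c
vertices↔ = ↔-trans +↔⊎ (↔-trans +↔⊎ ⊎-self↔×Bool ⊎-↔ ↔-trans +↔⊎ ⊎-self↔×Bool)

members : ∀ {n} → Subset n → List (Fin n)
members []          = []
members (true ∷ p)  = zero ∷ map suc (members p)
members (false ∷ p) = map suc (members p)

length-members : ∀ {n} (p : Subset n) → length (members p) ≡ ∣ p ∣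
length-members []          = refl
length-members (true ∷ p)  = cong suc (trans (length-map suc (members p)) (length-members p))
length-members (false ∷ p) = trans (length-map suc (members p)) (length-members p)

∈-members : ∀ {n} {u : Fin n} {p : Subset n} → u ∈ₛ p → u ∈ members p
∈-members {p = true ∷ _}  here        = here refl
∈-members {p = true ∷ _}  (there u∈p) = there (∈-map⁺ suc (∈-members u∈p))
∈-members {p = false ∷ _} (there u∈p) = ∈-map⁺ suc (∈-members u∈p)

does≡true⇒ : ∀ {a} {A : Set a} (a? : Dec A) → does a? ≡ true → A
does≡true⇒ (yes a) _ = a

module AdjacencyMatrix {r c : ℕ} (e : Fin r → Fin c → Bool) where
  open MatrixGraph e
  open Inverse (vertices↔ {r} {c}) using (strictlyInverseˡ; strictlyInverseʳ) renaming (to to vertex; from to index)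

  vertex-injective : ∀ {u u′} → vertex u ≡ vertex u′ → u ≡ u′
  vertex-injective {u} {u′} same = trans (sym (strictlyInverseʳ u)) (trans (cong index same) (strictlyInverseʳ u′))

  graph : Matrix ((r + r) + (c + c)) ((r + r) + (c + c))
  graph = tabulate λ x → tabulate λ y → adjacent (vertex x) (vertex y)

  entry-graph : ∀ x y → entry graph x y ≡ adjacent (vertex x) (vertex y)
  entry-graph = entry-tabulate (λ x y → adjacent (vertex x) (vertex y))

  entry-graph-index : ∀ v u → entry graph (index v) u ≡ adjacent v (vertex u)
  entry-graph-index v u = trans (entry-graph (index v) u) (cong (λ w → adjacent w (vertex u)) (strictlyInverseˡ v))

  graph-isGraph : IsGraph graph
  graph-isGraph = (λ x → trans (entry-graph x x) (adjacent-irreflexive (vertex x)))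
                , (λ x y → trans (entry-graph x y) (trans (adjacent-sym (vertex x) (vertex y)) (sym (entry-graph y x))))

  graph-triangleFree : TriangleFree graph
  graph-triangleFree x y z xy yz xz = triangle-free (vertex x) (vertex y) (vertex z)
    (trans (sym (entry-graph x y)) xy) (trans (sym (entry-graph y z)) yz) (trans (sym (entry-graph x z)) xz)

  entry-graph-row-col : ∀ i l → entry graph (index (row i false)) (index (col l false)) ≡ e i l
  entry-graph-row-col i l = trans (entry-graph-index (row i false) (index (col l false)))
    (trans (cong (adjacent (row i false)) (strictlyInverseˡ (col l false))) (xor-identityʳ (e i l)))

  module _ (3≤r : 3 ≤ r) (3≤c : 3 ≤ c)
           (rows-shattered : ThreeShattered e) (columns-shattered : ThreeShattered (λ l i → e i l)) where
    open Extension e 3≤r 3≤c rows-shattered columns-shattered using (extension-list)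

    graph-threeECTF : ThreeECTF graph
    graph-threeECTF = graph-triangleFree , extend
      where
      extend : ∀ A B → B ⊆ A → ∣ A ∣ ≤ 3 → Independent graph B → ∃ λ v → v ∉ₛ A ×
        (∀ u → u ∈ₛ B → Adj graph v u) × (∀ u → u ∈ₛ A → u ∉ₛ B → ¬ Adj graph v u)
      extend A B B⊆A |A|≤3 B-independent = index v , index-v∉A , adjacent-to-B , non-adjacent-off-B
        where
        constraint : Fin ((r + r) + (c + c)) → Constraint
        constraint u = vertex u , does (u ∈ₛ? B)
        constraints = map constraint (members A)
        compatible-∈ : ∀ {x y} → x ∈ constraints → y ∈ constraints → Compatible x y
        compatible-∈ x∈ y∈ with u , _ , refl ← ∈-map⁻ constraint x∈ | u′ , _ , refl ← ∈-map⁻ constraint y∈ =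
          compatible (λ same → cong (λ w → does (w ∈ₛ? B)) (vertex-injective same))
                     (λ u∈B u′∈B → ¬-not λ adj → B-independent u u′ (does≡true⇒ (u ∈ₛ? B) u∈B) (does≡true⇒ (u′ ∈ₛ? B) u′∈B)
                                                   (trans (entry-graph u u′) adj))
        solution = extension-list constraints
          (≤-trans (≤-reflexive (trans (length-map constraint (members A)) (length-members A))) |A|≤3) compatible-∈
        v = proj₁ solution
        satisfies-A : ∀ {u} → u ∈ₛ A → v satisfies constraint u
        satisfies-A u∈A = proj₂ solution (∈-map⁺ constraint (∈-members u∈A))
        index-v∉A : index v ∉ₛ A
        index-v∉A v∈A = _satisfies_.distinct (satisfies-A v∈A) (sym (strictlyInverseˡ v))
        adjacent-to-B : ∀ u → u ∈ₛ B → Adj graph (index v) u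
        adjacent-to-B u u∈B = trans (entry-graph-index v u)
          (trans (_satisfies_.adjacency (satisfies-A (B⊆A u∈B))) (dec-true (u ∈ₛ? B) u∈B))
        non-adjacent-off-B : ∀ u → u ∈ₛ A → u ∉ₛ B → ¬ Adj graph (index v) u
        non-adjacent-off-B u u∈A u∉B adj with () ← trans (sym adj) (trans (entry-graph-index v u)
          (trans (_satisfies_.adjacency (satisfies-A u∈A)) (dec-false (u ∈ₛ? B) u∉B)))

numShattered≤numThreeECTF : ∀ r c → 3 ≤ r → 3 ≤ c → numShattered r c ≤ numThreeECTF ((r + r) + (c + c))
numShattered≤numThreeECTF r c 3≤r 3≤c =
  length-filter-≤-by-injection shattered? (λ M G → G ≡ graph (entry M)) injective (allMatrices-unique r c)
    λ {M} _ (rows , columns) → graph (entry M) ,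
      ∈-filter⁺ (λ G → isGraph? G ×-dec threeECTF? G) (∈-allMatrices _)
        (graph-isGraph (entry M) , graph-threeECTF (entry M) 3≤r 3≤c rows columns) , refl
  where
  open AdjacencyMatrix
  injective : ∀ {M M′ : Matrix r c} {G} → G ≡ graph (entry M) → G ≡ graph (entry M′) → M ≡ M′
  injective {M} {M′} refl same = entry-ext λ i l → begin
    entry M i l                                     ≡⟨ sym (entry-graph-row-col (entry M) i l) ⟩
    entry (graph (entry M)) (index′ (row i false)) (index′ (col l false)) ≡⟨ cong (λ G → entry G _ _) same ⟩
    entry (graph (entry M′)) (index′ (row i false)) (index′ (col l false)) ≡⟨ entry-graph-row-col (entry M′) i l ⟩
    entry M′ i l                                    ∎
    where
    open ≡-Reasoning
    index′ = Inverse.from (vertices↔ {r} {c})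

-- (m + 2)¹⁰ ≤ 2 (m + 1)¹⁰ as soon as 15 (m + 2) ≤ 16 (m + 1), because 16¹⁰ ≤ 2 · 15¹⁰.
^10-step : ∀ m → 14 ≤ m → suc (suc m) ^ 10 ≤ 2 * suc m ^ 10
^10-step m 14≤m = *-cancelˡ-≤ (15 ^ 10) (begin
  15 ^ 10 * suc (suc m) ^ 10 ≡⟨ sym (^-distribʳ-* 15 (suc (suc m)) 10) ⟩
  (15 * suc (suc m)) ^ 10    ≤⟨ ^-monoˡ-≤ 10 linear ⟩
  (16 * suc m) ^ 10          ≡⟨ ^-distribʳ-* 16 (suc m) 10 ⟩
  16 ^ 10 * suc m ^ 10       ≤⟨ *-monoˡ-≤ (suc m ^ 10) (toWitness {a? = 16 ^ 10 ≤? 2 * 15 ^ 10} _) ⟩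
  2 * 15 ^ 10 * suc m ^ 10   ≡⟨ solve 2 (λ a b → con 2 :* a :* b := a :* (con 2 :* b)) refl (15 ^ 10) (suc m ^ 10) ⟩
  15 ^ 10 * (2 * suc m ^ 10) ∎)
  where
  open ≤-Reasoning
  linear : 15 * suc (suc m) ≤ 16 * suc m
  linear = begin
    15 * suc (suc m)    ≡⟨ solve 1 (λ m → con 15 :* (con 2 :+ m) := con 14 :+ (con 16 :+ con 15 :* m)) refl m ⟩
    14 + (16 + 15 * m)  ≤⟨ +-monoˡ-≤ (16 + 15 * m) 14≤m ⟩
    m + (16 + 15 * m)   ≡⟨ solve 1 (λ m → m :+ (con 16 :+ con 15 :* m) := con 16 :* (con 1 :+ m)) refl m ⟩
    16 * suc m          ∎

suc^10≤2^ : ∀ c → 60 ≤ c → suc c ^ 10 ≤ 2 ^ c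
suc^10≤2^ c 60≤c = subst (λ c → suc c ^ 10 ≤ 2 ^ c) (m∸n+n≡m 60≤c) (from60 (c ∸ 60))
  where
  from60 : ∀ d → suc (d + 60) ^ 10 ≤ 2 ^ (d + 60)
  from60 zero    = toWitness {a? = 61 ^ 10 ≤? 2 ^ 60} _
  from60 (suc d) = ≤-trans (^10-step (d + 60) (≤-trans (toWitness {a? = 14 ≤? 60} _) (m≤n+m 60 d)))
                           (*-monoʳ-≤ 2 (from60 d))

2*[x∸y]≤x⇒x≤2*y : ∀ x y → 2 * (x ∸ y) ≤ x → x ≤ 2 * y
2*[x∸y]≤x⇒x≤2*y x y 2D≤x = begin
  x             ≤⟨ m≤n+m∸n x y ⟩
  y + (x ∸ y)   ≤⟨ +-monoʳ-≤ y D≤y ⟩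
  y + y         ≡⟨ cong (y +_) (sym (+-identityʳ y)) ⟩
  2 * y         ∎
  where
  open ≤-Reasoning
  D≤y : x ∸ y ≤ y
  D≤y = +-cancelʳ-≤ (x ∸ y) (x ∸ y) y (begin
    (x ∸ y) + (x ∸ y) ≡⟨ cong ((x ∸ y) +_) (sym (+-identityʳ (x ∸ y))) ⟩
    2 * (x ∸ y)       ≤⟨ 2D≤x ⟩
    x                 ≤⟨ m≤n+m∸n x y ⟩
    y + (x ∸ y)       ∎)

2^≤^ : ∀ a b E T → 2 ^ a ≤ 2 * T → b + E ≤ a * E → 2 ^ b ≤ T ^ E
2^≤^ a b E T 2ᵃ≤2T b+E≤aE = *-cancelʳ-≤ (2 ^ b) (T ^ E) (2 ^ E) {{m^n≢0 2 E}} (begin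
  2 ^ b * 2 ^ E    ≡⟨ sym (^-distribˡ-+-* 2 b E) ⟩
  2 ^ (b + E)      ≤⟨ ^-monoʳ-≤ 2 b+E≤aE ⟩
  2 ^ (a * E)      ≡⟨ sym (^-*-assoc 2 a E) ⟩
  (2 ^ a) ^ E      ≤⟨ ^-monoˡ-≤ E 2ᵃ≤2T ⟩
  (2 * T) ^ E      ≡⟨ ^-distribʳ-* 2 T E ⟩
  2 ^ E * T ^ E    ≡⟨ *-comm (2 ^ E) (T ^ E) ⟩
  T ^ E * 2 ^ E    ∎)
  where open ≤-Reasoning

Balanced : ℕ → ℕ → Set
Balanced r c = r ≡ c ⊎ r ≡ suc c

balanced-bounds : ∀ {r c} → Balanced r c → c ≤ r × r ≤ suc c
balanced-bounds (inj₁ refl) = ≤-refl , n≤1+n _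
balanced-bounds (inj₂ refl) = n≤1+n _ , ≤-refl

halve : ∀ q → ∃ λ r → ∃ λ c → q ≡ r + c × Balanced r c
halve zero = 0 , 0 , refl , inj₁ refl
halve (suc q) with halve q
... | r , _ , refl , inj₁ refl = suc r , r , refl , inj₂ refl
... | _ , c , refl , inj₂ refl = suc c , suc c , cong suc (sym (+-suc c c)) , inj₁ refl

halve-even : ∀ q → ∃ λ r → ∃ λ c → q * 2 ≡ (r + r) + (c + c) × Balanced r c
halve-even q with r , c , refl , r≈c ← halve q =
  r , c , solve 2 (λ r c → (r :+ c) :* con 2 := (r :+ r) :+ (c :+ c)) refl r c , r≈c

square-bound : ∀ r c → Balanced r c → ((r + r) + (c + c)) * ((r + r) + (c + c)) ≤ 16 * (r * c) + 4
square-bound r c (inj₁ refl) = ≤-trans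
  (≤-reflexive (solve 1 (λ c → (c :+ c :+ (c :+ c)) :* (c :+ c :+ (c :+ c)) := con 16 :* (c :* c)) refl c))
  (m≤m+n (16 * (c * c)) 4)
square-bound r c (inj₂ refl) = ≤-reflexive
  (solve 1 (λ c → ((con 1 :+ c) :+ (con 1 :+ c) :+ (c :+ c)) :* ((con 1 :+ c) :+ (con 1 :+ c) :+ (c :+ c))
                  := con 16 :* ((con 1 :+ c) :* c) :+ con 4) refl c)

size≤4[1+c] : ∀ r c → Balanced r c → (r + r) + (c + c) ≤ 4 * suc c
size≤4[1+c] r c r≈c = ≤-trans (+-mono-≤ (+-mono-≤ r≤1+c r≤1+c) (+-mono-≤ (n≤1+n c) (n≤1+n c)))
  (≤-reflexive (solve 1 (λ c → (con 1 :+ c) :+ (con 1 :+ c) :+ ((con 1 :+ c) :+ (con 1 :+ c)) := con 4 :* (con 1 :+ c)) refl c))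
  where r≤1+c = proj₂ (balanced-bounds r≈c)

exponent-bound : ∀ n P K → n * n ≤ 16 * P + 4 → 20 * K + 1 ≤ P → n * n * K + (16 * K + 1) ≤ P * (16 * K + 1)
exponent-bound n P K n²≤ 20K+1≤P = begin
  n * n * K + (16 * K + 1)        ≤⟨ +-monoˡ-≤ (16 * K + 1) (*-monoˡ-≤ K n²≤) ⟩
  (16 * P + 4) * K + (16 * K + 1) ≡⟨ solve 2 (λ P K → (con 16 :* P :+ con 4) :* K :+ (con 16 :* K :+ con 1)
                                                     := con 16 :* P :* K :+ (con 20 :* K :+ con 1)) refl P K ⟩
  16 * P * K + (20 * K + 1)       ≤⟨ +-monoʳ-≤ (16 * P * K) 20K+1≤P ⟩
  16 * P * K + P                  ≡⟨ solve 2 (λ P K → con 16 :* P :* K :+ P := P :* (con 16 :* K :+ con 1)) refl P K ⟩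
  P * (16 * K + 1)                ∎
  where open ≤-Reasoning

m+n+o≤p⇒ : ∀ m n o {p} → m + n + o ≤ p → m ≤ p × n ≤ p × o ≤ p
m+n+o≤p⇒ m n o m+n+o≤p =
  ≤-trans (≤-trans (m≤m+n m n) (m≤m+n (m + n) o)) m+n+o≤p ,
  ≤-trans (≤-trans (m≤n+m n m) (m≤m+n (m + n) o)) m+n+o≤p ,
  ≤-trans (m≤n+m o (m + n)) m+n+o≤p

-- The huge literal comes last: a literal to the left of a variable is unfolded into sucs by the type checker.
threshold : ℕ → ℕ
threshold k = 60 + (20 * suc k + 1) + ((16 * 2) ^ 10 + 3)

numThreeECTF-large : ∀ k r c → Balanced r c → threshold k ≤ c →
  let n = (r + r) + (c + c) in 2 ^ (n * n * suc k) ≤ numThreeECTF n ^ (16 * suc k + 1)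
numThreeECTF-large k r c r≈c T≤c =
  2^≤^ (r * c) (n * n * K) (16 * K + 1) (numThreeECTF n) 2^rc≤2T (exponent-bound n (r * c) K (square-bound r c r≈c) 20K+1≤rc)
  where
  n = (r + r) + (c + c)
  K = suc k
  bounds = m+n+o≤p⇒ 60 (20 * K + 1) ((16 * 2) ^ 10 + 3) T≤c
  60≤c = proj₁ bounds
  20K+1≤c = proj₁ (proj₂ bounds)
  N≤c = proj₂ (proj₂ bounds)
  c≤r = proj₁ (balanced-bounds r≈c)
  3≤c : 3 ≤ c
  3≤c = ≤-trans (m≤m+n 3 57) 60≤c
  c¹⁰≤2ʳ : c ^ 10 ≤ 2 ^ r
  c¹⁰≤2ʳ = ≤-trans (^-monoˡ-≤ 10 (n≤1+n c)) (≤-trans (suc^10≤2^ c 60≤c) (^-monoʳ-≤ 2 c≤r))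
  r¹⁰≤2ᶜ : r ^ 10 ≤ 2 ^ c
  r¹⁰≤2ᶜ = ≤-trans (^-monoˡ-≤ 10 (proj₂ (balanced-bounds r≈c))) (suc^10≤2^ c 60≤c)
  2^rc≤2T : 2 ^ (r * c) ≤ 2 * numThreeECTF n
  2^rc≤2T = ≤-trans
    (2*[x∸y]≤x⇒x≤2*y (2 ^ (r * c)) (numShattered r c) (shattered-proportion 1 r c (≤-trans N≤c c≤r) N≤c c¹⁰≤2ʳ r¹⁰≤2ᶜ))
    (*-monoʳ-≤ 2 (numShattered≤numThreeECTF r c (≤-trans 3≤c c≤r) 3≤c))
  20K+1≤rc : 20 * K + 1 ≤ r * c
  20K+1≤rc = ≤-trans 20K+1≤c (≤-trans (≤-reflexive (sym (*-identityˡ c))) (*-monoˡ-≤ c (≤-trans (s≤s z≤n) (≤-trans 3≤c c≤r))))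

numThreeECTF-large-even : ∀ k n → 2 ∣ n → 4 * suc (threshold k) ≤ n →
  2 ^ (n * n * suc k) ≤ numThreeECTF n ^ (16 * suc k + 1)
numThreeECTF-large-even k _ (divides q refl) N≤n with r , c , n≡ , r≈c ← halve-even q =
  subst (λ n → 2 ^ (n * n * suc k) ≤ numThreeECTF n ^ (16 * suc k + 1)) (sym n≡)
    (numThreeECTF-large k r c r≈c (≤-pred (*-cancelˡ-≤ 4 (≤-trans N≤n (≤-trans (≤-reflexive n≡) (size≤4[1+c] r c r≈c))))))

corollary6 : (∃ λ (C : ℕ) → 0 < C ×
    (∀ (k : ℕ) → ∃ λ (N : ℕ) → ∀ (m n : ℕ) → N ≤ m → N ≤ n →
      n ^ C ≤ 2 ^ m → m ^ C ≤ 2 ^ n →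
      suc k * (2 ^ (m * n) ∸ numShattered m n) ≤ 2 ^ (m * n)))
    ×
    (∀ (k : ℕ) → ∃ λ (N : ℕ) → ∀ (n : ℕ) → 2 ∣ n → N ≤ n →
        2 ^ (n * n * suc k) ≤ numThreeECTF n ^ (16 * suc k + 1))
corollary6 = (10 , s≤s z≤n , λ k → (16 * suc k) ^ 10 + 3 , shattered-proportion k)
           , λ k → 4 * suc (threshold k) , numThreeECTF-large-even k
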